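{- For any partition $\mu=(\mu_1,\dots,\mu_s)\vdash n$ with $s\ge 2$, $$\sum_{k=1}^{\mu_s}\binom{\mu_s}{k}(2k+1)!!\,f(\mu\setminus\mu_s-\hat{k})=(2\mu_s+1)f(\mu)-2\mu_s f(\mu^{\downarrow s})-f(\mu\setminus\mu_s).$$
   Context: Partitions are non-increasing sequences of positive integers; $\lambda\vdash n$ means the parts sum to $n$. For $\lambda=(\lambda_1,\dots,\lambda_r)$: $\lambda\setminus\lambda_r:=(\lambda_1,\dots,\lambda_{r-1})$; for $1\le k\le\lambda_r$, $\lambda-\hat{k}:=(\lambda_1-k,\dots,\lambda_r-k)$; in all sequences, zero parts are deleted and the all-zero sequence is identified with $(0)$. For $\mu=(\mu_1,\dots,\mu_s)$, $\mu^{\downarrow s}$ is the partition obtained by replacing $\mu_s$ by $\mu_s-1$ (deleting it if it becomes $0$). Define $d_0=1$, $d_1=0$, $d_n=2(n-1)(d_{n-1}+d_{n-2})$ for $n\ge2$. Define $f$ on partitions recursively: $f((0))=1$; $f((n))=d_n$ for $n\ge1$; and for $\lambda=(\lambda_1,\dots,\lambda_r)$ with $r\ge 2$, $$f(\lambda)=f(\lambda\setminus\lambda_r)+\sum_{k=1}^{\lambda_r}\binom{\lambda_r}{k}(2k-1)!!\,f(\lambda\setminus\lambda_r-\hat{k}),$$ where $(2k-1)!!=1\cdot3\cdots(2k-1)$. (It is known that $f(\lambda)=(-1)^{n-\lambda_1}\eta_\lambda$, where $\eta_\lambda$ are the eigenvalues of the perfect matching derangement graph on $K_{2n}$.) -}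

module Defs where

open import Data.Nat using (ℕ; zero; suc; _+_; _*_; _∸_; _<_; _≥_)
open import Data.Nat.Combinatorics using (_C_)
open import Data.List using (List; []; _∷_; _++_; map; filterᵇ; length)
open import Data.Nat.ListAction using (sum)
open import Data.List.Relation.Unary.All using (All)
open import Data.List.Relation.Unary.Linked using (Linked)
open import Data.Bool using (Bool; true; false)
open import Data.Product using (_×_)
open import Relation.Binary.PropositionalEquality using (_≡_)

-- Partitions: lists (λ₁, …, λ_r) of positive naturals, non-increasing.
-- The partition (0) is represented by the empty list [] (zero parts deleted).
IsPartition : List ℕ → Set
IsPartition λs = All (0 <_) λs × Linked _≥_ λs

_⊢_ : List ℕ → ℕ → Set
λs ⊢ n = IsPartition λs × sum λs ≡ n

isPos : ℕ → Bool
isPos zero    = false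
isPos (suc _) = true

dropZeros : List ℕ → List ℕ
dropZeros = filterᵇ isPos

initNE : ℕ → List ℕ → List ℕ
initNE a []       = []
initNE a (b ∷ xs) = a ∷ initNE b xs

lastNE : ℕ → List ℕ → ℕ
lastNE a []       = a
lastNE a (b ∷ xs) = lastNE b xs

removeLast : List ℕ → List ℕ
removeLast []       = []
removeLast (a ∷ xs) = initNE a xs

lastPart : List ℕ → ℕ
lastPart []       = 0
lastPart (a ∷ xs) = lastNE a xs

-- λ - k̂ : subtract k from every part, delete zero parts
subHat : List ℕ → ℕ → List ℕ
subHat λs k = dropZeros (map (_∸ k) λs)

-- μ^{↓s}: decrease the last part by one, deleting it if it becomes 0
decLast : List ℕ → List ℕ
decLast μ = dropZeros (removeLast μ ++ (lastPart μ ∸ 1 ∷ []))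

d : ℕ → ℕ
d zero          = 1
d (suc zero)    = 0
d (suc (suc n)) = 2 * suc n * (d (suc n) + d n)

-- oddDF k = (2k-1)!! = 1·3·⋯·(2k-1)   (oddDF 0 = 1)
oddDF : ℕ → ℕ
oddDF zero    = 1
oddDF (suc k) = (2 * k + 1) * oddDF k

sumFrom1 : ℕ → (ℕ → ℕ) → ℕ
sumFrom1 zero    g = 0
sumFrom1 (suc m) g = sumFrom1 m g + g (suc m)

-- f with fuel (fuel ≥ length suffices; every recursive call is on a
-- strictly shorter list, so the value does not depend on the fuel).
fF : ℕ → List ℕ → ℕ
fF _          []            = 1
fF _          (n ∷ [])      = d n
fF zero       (_ ∷ _ ∷ _)   = 0
fF (suc fuel) λs@(_ ∷ _ ∷ _) =
  fF fuel (removeLast λs)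
  + sumFrom1 (lastPart λs)
      (λ k → (lastPart λs C k) * oddDF k * fF fuel (subHat (removeLast λs) k))

f : List ℕ → ℕ
f λs = fF (length λs) λs

-- Write μ = ν ∷ʳ m. Then f μ and f μ^{↓s} are both given by the recursion of f on ν,
-- with last parts m and m − 1. Comparing the three sums term by term, the identity
-- reduces to (2k + 1)!! = (2k + 1)·(2k − 1)!! and the binomial identity
-- k·C(m,k) + m·C(m − 1,k) = m·C(m,k), a form of the absorption law k·C(m,k) = m·C(m − 1,k − 1).
module Submission where

open import Defs
open import Data.Nat using (ℕ; zero; suc; _+_; _*_; _≤_; _<_; _∸_; z≤n; s≤s; z<s)
open import Data.Nat.Properties
open import Data.Nat.Combinatorics
  using (_C_; nC1≡n; k>n⇒nCk≡0; nCk+nC[k+1]≡[n+1]C[k+1])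
open import Data.Nat.Tactic.RingSolver using (solve-∀)
open import Data.Bool using (T)
open import Data.Unit using (tt)
open import Data.List using (List; []; _∷_; _++_; _∷ʳ_; length; map)
open import Data.List.Properties using (length-map; length-filter; filter-++; filter-all; ++-identityʳ)
open import Data.List.Relation.Unary.All using (All)
import Data.List.Relation.Unary.All as All
open import Data.List.Relation.Unary.All.Properties using (++⁻ˡ)
open import Data.Product using (_,_)
open import Relation.Binary.PropositionalEquality
open import Relation.Nullary.Decidable using (T?)
open ≡-Reasoning

[1+k]*[1+n]C[1+k]≡[1+n]*nCk : ∀ n k → suc k * (suc n C suc k) ≡ suc n * (n C k)
[1+k]*[1+n]C[1+k]≡[1+n]*nCk n zero = trans (+-identityʳ _) (trans (nC1≡n (suc n)) (sym (*-identityʳ (suc n))))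
[1+k]*[1+n]C[1+k]≡[1+n]*nCk zero (suc k) = begin
  suc (suc k) * (1 C suc (suc k))  ≡⟨ cong (suc (suc k) *_) (k>n⇒nCk≡0 {1} {suc (suc k)} (s≤s z<s)) ⟩
  suc (suc k) * 0                  ≡⟨ *-zeroʳ (suc (suc k)) ⟩
  0                                ≡⟨ cong (1 *_) (k>n⇒nCk≡0 {0} {suc k} z<s) ⟨
  1 * (0 C suc k)                  ∎
[1+k]*[1+n]C[1+k]≡[1+n]*nCk (suc n) (suc k) = begin
  (2 + k) * ((2 + n) C (2 + k))                                    ≡⟨ cong ((2 + k) *_) (nCk+nC[k+1]≡[n+1]C[k+1] (suc n) (suc k)) ⟨
  (2 + k) * ((1 + n) C (1 + k) + (1 + n) C (2 + k))                ≡⟨ regroup ((1 + n) C (1 + k)) ((1 + n) C (2 + k)) k ⟩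
  (1 + k) * ((1 + n) C (1 + k)) + (1 + n) C (1 + k) + (2 + k) * ((1 + n) C (2 + k))
    ≡⟨ cong₂ (λ x y → x + (1 + n) C (1 + k) + y) ([1+k]*[1+n]C[1+k]≡[1+n]*nCk n k) ([1+k]*[1+n]C[1+k]≡[1+n]*nCk n (suc k)) ⟩
  (1 + n) * (n C k) + (1 + n) C (1 + k) + (1 + n) * (n C (1 + k))
    ≡⟨ cong (λ x → (1 + n) * (n C k) + x + (1 + n) * (n C (1 + k))) (nCk+nC[k+1]≡[n+1]C[k+1] n k) ⟨
  (1 + n) * (n C k) + (n C k + n C (1 + k)) + (1 + n) * (n C (1 + k))
    ≡⟨ collect (1 + n) (n C k) (n C (1 + k)) ⟩
  (2 + n) * (n C k + n C (1 + k))                                  ≡⟨ cong ((2 + n) *_) (nCk+nC[k+1]≡[n+1]C[k+1] n k) ⟩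
  (2 + n) * ((1 + n) C (1 + k))                                    ∎
  where
  regroup : ∀ a b k → (2 + k) * (a + b) ≡ (1 + k) * a + a + (2 + k) * b
  regroup = solve-∀
  collect : ∀ p x y → p * x + (x + y) + p * y ≡ (1 + p) * (x + y)
  collect = solve-∀

k*[1+n]Ck+[1+n]*nCk≡[1+n]*[1+n]Ck : ∀ n k → k * (suc n C k) + suc n * (n C k) ≡ suc n * (suc n C k)
k*[1+n]Ck+[1+n]*nCk≡[1+n]*[1+n]Ck n zero = refl
k*[1+n]Ck+[1+n]*nCk≡[1+n]*[1+n]Ck n (suc k) = begin
  suc k * (suc n C suc k) + suc n * (n C suc k)   ≡⟨ cong (_+ suc n * (n C suc k)) ([1+k]*[1+n]C[1+k]≡[1+n]*nCk n k) ⟩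
  suc n * (n C k) + suc n * (n C suc k)           ≡⟨ *-distribˡ-+ (suc n) (n C k) (n C suc k) ⟨
  suc n * (n C k + n C suc k)                     ≡⟨ cong (suc n *_) (nCk+nC[k+1]≡[n+1]C[k+1] n k) ⟩
  suc n * (suc n C suc k)                         ∎

oddDF-binomial-term : ∀ n k x →
  (suc n C k) * oddDF (1 + k) * x + 2 * suc n * ((n C k) * oddDF k * x)
  ≡ (2 * suc n + 1) * ((suc n C k) * oddDF k * x)
oddDF-binomial-term n k x = begin
  c * ((2 * k + 1) * o) * x + 2 * m * (c′ * o * x)  ≡⟨ expand c c′ k m o x ⟩
  (2 * (k * c + m * c′) + c) * o * x                 ≡⟨ cong (λ y → (2 * y + c) * o * x) (k*[1+n]Ck+[1+n]*nCk≡[1+n]*[1+n]Ck n k) ⟩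
  (2 * (m * c) + c) * o * x                          ≡⟨ contract c m o x ⟩
  (2 * m + 1) * (c * o * x)                          ∎
  where
  m = suc n
  c = suc n C k
  c′ = n C k
  o = oddDF k
  expand : ∀ c c′ k m o x → c * ((2 * k + 1) * o) * x + 2 * m * (c′ * o * x) ≡ (2 * (k * c + m * c′) + c) * o * x
  expand = solve-∀
  contract : ∀ c m o x → (2 * (m * c) + c) * o * x ≡ (2 * m + 1) * (c * o * x)
  contract = solve-∀

sumFrom1-cong : ∀ n {g h : ℕ → ℕ} → (∀ k → g k ≡ h k) → sumFrom1 n g ≡ sumFrom1 n h
sumFrom1-cong zero    g≗h = refl
sumFrom1-cong (suc n) g≗h = cong₂ _+_ (sumFrom1-cong n g≗h) (g≗h (suc n))

sumFrom1-+ : ∀ n (g h : ℕ → ℕ) → sumFrom1 n g + sumFrom1 n h ≡ sumFrom1 n (λ k → g k + h k)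
sumFrom1-+ zero    g h = refl
sumFrom1-+ (suc n) g h = begin
  sumFrom1 n g + g (suc n) + (sumFrom1 n h + h (suc n))  ≡⟨ interchange (sumFrom1 n g) (g (suc n)) (sumFrom1 n h) (h (suc n)) ⟩
  sumFrom1 n g + sumFrom1 n h + (g (suc n) + h (suc n))  ≡⟨ cong (_+ (g (suc n) + h (suc n))) (sumFrom1-+ n g h) ⟩
  sumFrom1 n (λ k → g k + h k) + (g (suc n) + h (suc n)) ∎
  where
  interchange : ∀ a b c e → a + b + (c + e) ≡ a + c + (b + e)
  interchange = solve-∀

*-distribˡ-sumFrom1 : ∀ n c (g : ℕ → ℕ) → c * sumFrom1 n g ≡ sumFrom1 n (λ k → c * g k)
*-distribˡ-sumFrom1 zero    c g = *-zeroʳ c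
*-distribˡ-sumFrom1 (suc n) c g =
  trans (*-distribˡ-+ c (sumFrom1 n g) (g (suc n))) (cong (_+ c * g (suc n)) (*-distribˡ-sumFrom1 n c g))

length-initNE : ∀ a xs → length (initNE a xs) ≡ length xs
length-initNE a []       = refl
length-initNE a (b ∷ xs) = cong suc (length-initNE b xs)

length-subHat : ∀ xs k → length (subHat xs k) ≤ length xs
length-subHat xs k = ≤-trans (length-filter (λ x → T? (isPos x)) (map (_∸ k) xs)) (≤-reflexive (length-map (_∸ k) xs))

removeLast-∷ʳ : ∀ xs (m : ℕ) → removeLast (xs ∷ʳ m) ≡ xs
removeLast-∷ʳ []           m = refl
removeLast-∷ʳ (a ∷ [])     m = refl
removeLast-∷ʳ (a ∷ b ∷ xs) m = cong (a ∷_) (removeLast-∷ʳ (b ∷ xs) m)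

lastPart-∷ʳ : ∀ xs (m : ℕ) → lastPart (xs ∷ʳ m) ≡ m
lastPart-∷ʳ []           m = refl
lastPart-∷ʳ (a ∷ [])     m = refl
lastPart-∷ʳ (a ∷ b ∷ xs) m = lastPart-∷ʳ (b ∷ xs) m

initNE-∷ʳ-lastNE : ∀ (a : ℕ) xs → a ∷ xs ≡ initNE a xs ∷ʳ lastNE a xs
initNE-∷ʳ-lastNE a []       = refl
initNE-∷ʳ-lastNE a (b ∷ xs) = cong (a ∷_) (initNE-∷ʳ-lastNE b xs)

dropZeros-positive : ∀ {xs} → All (0 <_) xs → dropZeros xs ≡ xs
dropZeros-positive ps = filter-all (λ x → T? (isPos x)) (All.map positive⇒isPos ps)
  where
  positive⇒isPos : ∀ {x} → 0 < x → T (isPos x)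
  positive⇒isPos (s≤s z≤n) = tt

dropZeros-∷ʳ : ∀ {xs} → All (0 <_) xs → ∀ m → dropZeros (xs ∷ʳ m) ≡ xs ++ dropZeros (m ∷ [])
dropZeros-∷ʳ {xs} ps m = trans (filter-++ _ xs (m ∷ [])) (cong (_++ dropZeros (m ∷ [])) (dropZeros-positive ps))

fF-fuel : ∀ F G xs → length xs ≤ suc F → length xs ≤ suc G → fF F xs ≡ fF G xs
fF-fuel F       G       []           _       _       = refl
fF-fuel F       G       (x ∷ [])     _       _       = refl
fF-fuel zero    G       (x ∷ y ∷ zs) (s≤s ()) _
fF-fuel (suc F) zero    (x ∷ y ∷ zs) _       (s≤s ())
fF-fuel (suc F) (suc G) (x ∷ y ∷ zs) (s≤s p) (s≤s q) =
  cong₂ _+_ (fF-fuel F G ν (shorter p) (shorter q))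
    (sumFrom1-cong (lastNE y zs) λ k → cong ((lastNE y zs C k) * oddDF k *_)
      (fF-fuel F G (subHat ν k) (≤-trans (length-subHat ν k) (shorter p)) (≤-trans (length-subHat ν k) (shorter q))))
  where
  ν = x ∷ initNE y zs
  shorter : ∀ {H} → suc (length zs) ≤ suc H → length ν ≤ suc H
  shorter = ≤-trans (≤-reflexive (cong suc (length-initNE y zs)))

fF≡f : ∀ F xs → length xs ≤ suc F → fF F xs ≡ f xs
fF≡f F xs p = fF-fuel F (length xs) xs p (n≤1+n _)

fRec : List ℕ → ℕ → ℕ
fRec ν m = f ν + sumFrom1 m (λ k → (m C k) * oddDF k * f (subHat ν k))

f-unfold : ∀ a b zs → f (a ∷ b ∷ zs) ≡ fRec (removeLast (a ∷ b ∷ zs)) (lastPart (a ∷ b ∷ zs))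
f-unfold a b zs =
  cong₂ _+_ (fF≡f F ν ν-fits)
    (sumFrom1-cong (lastNE b zs) λ k → cong ((lastNE b zs C k) * oddDF k *_)
      (fF≡f F (subHat ν k) (≤-trans (length-subHat ν k) ν-fits)))
  where
  F = suc (length zs)
  ν = a ∷ initNE b zs
  ν-fits : length ν ≤ suc F
  ν-fits = ≤-trans (≤-reflexive (cong suc (length-initNE b zs))) (n≤1+n _)

f-∷ʳ : ∀ a ys m → f ((a ∷ ys) ∷ʳ m) ≡ fRec (a ∷ ys) m
f-∷ʳ a []       m = f-unfold a m []
f-∷ʳ a (b ∷ zs) m =
  trans (f-unfold a b (zs ∷ʳ m)) (cong₂ fRec (removeLast-∷ʳ (a ∷ b ∷ zs) m) (lastPart-∷ʳ (a ∷ b ∷ zs) m))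

f-dropZeros-∷ʳ : ∀ a ys m → All (0 <_) (a ∷ ys) → f (dropZeros ((a ∷ ys) ∷ʳ m)) ≡ fRec (a ∷ ys) m
f-dropZeros-∷ʳ a ys zero    ps = begin
  f (dropZeros ((a ∷ ys) ∷ʳ 0))  ≡⟨ cong f (trans (dropZeros-∷ʳ ps 0) (++-identityʳ (a ∷ ys))) ⟩
  f (a ∷ ys)                     ≡⟨ +-identityʳ (f (a ∷ ys)) ⟨
  fRec (a ∷ ys) 0                ∎
f-dropZeros-∷ʳ a ys (suc m) ps = trans (cong f (dropZeros-∷ʳ ps (suc m))) (f-∷ʳ a ys (suc m))

lemma2p1-∷ʳ : ∀ a ys m → All (0 <_) (a ∷ ys) →
  sumFrom1 m (λ k → (m C k) * oddDF (1 + k) * f (subHat (a ∷ ys) k))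
    + 2 * m * f (dropZeros ((a ∷ ys) ∷ʳ (m ∸ 1))) + f (a ∷ ys)
  ≡ (2 * m + 1) * f ((a ∷ ys) ∷ʳ m)
lemma2p1-∷ʳ a ys zero ps = sym (trans (+-identityʳ _) (trans (f-∷ʳ a ys 0) (+-identityʳ _)))
lemma2p1-∷ʳ a ys (suc n) ps = begin
  sumFrom1 m t₁ + 2 * m * f (dropZeros (ν ∷ʳ n)) + F  ≡⟨ cong (λ y → sumFrom1 m t₁ + 2 * m * y + F) (f-dropZeros-∷ʳ a ys n ps) ⟩
  sumFrom1 m t₁ + 2 * m * (F + sumFrom1 n t₂) + F     ≡⟨ cong (λ y → sumFrom1 m t₁ + 2 * m * (F + y) + F) t₂-vanishes ⟨
  sumFrom1 m t₁ + 2 * m * (F + sumFrom1 m t₂) + F     ≡⟨ regroup (sumFrom1 m t₁) m F (sumFrom1 m t₂) ⟩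
  (sumFrom1 m t₁ + 2 * m * sumFrom1 m t₂) + (2 * m + 1) * F
    ≡⟨ cong (_+ (2 * m + 1) * F) merge ⟩
  sumFrom1 m (λ k → (2 * m + 1) * t₃ k) + (2 * m + 1) * F
    ≡⟨ cong (_+ (2 * m + 1) * F) (*-distribˡ-sumFrom1 m (2 * m + 1) t₃) ⟨
  (2 * m + 1) * sumFrom1 m t₃ + (2 * m + 1) * F       ≡⟨ factor m (sumFrom1 m t₃) F ⟩
  (2 * m + 1) * fRec ν m                              ≡⟨ cong ((2 * m + 1) *_) (f-∷ʳ a ys m) ⟨
  (2 * m + 1) * f (ν ∷ʳ m)                            ∎
  where
  ν = a ∷ ys
  m = suc n
  F = f ν
  t₁ t₂ t₃ : ℕ → ℕ
  t₁ k = (m C k) * oddDF (1 + k) * f (subHat ν k)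
  t₂ k = (n C k) * oddDF k * f (subHat ν k)
  t₃ k = (m C k) * oddDF k * f (subHat ν k)
  t₂-vanishes : sumFrom1 m t₂ ≡ sumFrom1 n t₂
  t₂-vanishes = trans (cong (λ c → sumFrom1 n t₂ + c * oddDF m * f (subHat ν m)) (k>n⇒nCk≡0 (n<1+n n)))
                      (+-identityʳ _)
  merge : sumFrom1 m t₁ + 2 * m * sumFrom1 m t₂ ≡ sumFrom1 m (λ k → (2 * m + 1) * t₃ k)
  merge = begin
    sumFrom1 m t₁ + 2 * m * sumFrom1 m t₂           ≡⟨ cong (sumFrom1 m t₁ +_) (*-distribˡ-sumFrom1 m (2 * m) t₂) ⟩
    sumFrom1 m t₁ + sumFrom1 m (λ k → 2 * m * t₂ k) ≡⟨ sumFrom1-+ m t₁ (λ k → 2 * m * t₂ k) ⟩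
    sumFrom1 m (λ k → t₁ k + 2 * m * t₂ k)          ≡⟨ sumFrom1-cong m (λ k → oddDF-binomial-term n k (f (subHat ν k))) ⟩
    sumFrom1 m (λ k → (2 * m + 1) * t₃ k)           ∎
  regroup : ∀ S m F T → S + 2 * m * (F + T) + F ≡ (S + 2 * m * T) + (2 * m + 1) * F
  regroup = solve-∀
  factor : ∀ m S F → (2 * m + 1) * S + (2 * m + 1) * F ≡ (2 * m + 1) * (F + S)
  factor = solve-∀

lemma2p1 : (n : ℕ) (μ : List ℕ) → μ ⊢ n → 2 ≤ length μ →
    sumFrom1 (lastPart μ)
      (λ k → (lastPart μ C k) * oddDF (1 + k) * f (subHat (removeLast μ) k))
      + 2 * lastPart μ * f (decLast μ) + f (removeLast μ)
    ≡ (2 * lastPart μ + 1) * f μ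
lemma2p1 n (a ∷ b ∷ zs) ((positive , _) , _) _ =
  trans (lemma2p1-∷ʳ a (initNE b zs) m (++⁻ˡ (a ∷ initNE b zs) (subst (All (0 <_)) μ≡ν∷ʳm positive)))
        (cong (λ μ → (2 * m + 1) * f μ) (sym μ≡ν∷ʳm))
  where
  m = lastNE b zs
  μ≡ν∷ʳm : a ∷ b ∷ zs ≡ (a ∷ initNE b zs) ∷ʳ m
  μ≡ν∷ʳm = cong (a ∷_) (initNE-∷ʳ-lastNE b zs)
lemma2p1 n (a ∷ []) _ (s≤s ())
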